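{- Let $H$ be an arbitrary finite simple graph and let $F = P_3 \sqcup K_1 \sqcup H$. Then $D[F] \leq v(F) - 1$.
   Context: All graphs are finite simple graphs. Consider first-order logic over graphs whose signature consists of two binary predicate symbols: $\sim$ (adjacency) and $=$ (equality). For a graph $F$, let $\mathcal{C}[F]$ be the property (class of graphs) of containing an induced subgraph isomorphic to $F$. A sentence $\varphi$ expresses $\mathcal{C}[F]$ if for every graph $G$: $G \models \varphi \iff G \in \mathcal{C}[F]$. $D[F]$ denotes the minimal quantifier depth (maximal length of a chain of nested quantifiers) of a first-order sentence expressing $\mathcal{C}[F]$. $v(F)$ is the number of vertices of $F$. $P_3$ is the path on $3$ vertices, $K_1$ is the one-vertex graph, and $A \sqcup B$ denotes the disjoint union of graphs $A$ and $B$. -}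

module Defs where

open import Data.Nat using (ℕ; zero; suc; _+_; _≤_; _∸_)
open import Data.Fin using (Fin; zero; suc; splitAt)
open import Data.Bool using (Bool; true; false)
open import Data.Sum using (_⊎_; inj₁; inj₂)
open import Data.Product using (Σ; _×_; _,_)
open import Data.Empty using (⊥)
open import Relation.Binary.PropositionalEquality using (_≡_; refl)
open import Function.Definitions using (Injective)

record Graph : Set where
  field
    v      : ℕ
    adj    : Fin v → Fin v → Bool
    sym    : ∀ i j → adj i j ≡ adj j i
    irrefl : ∀ i → adj i i ≡ false
open Graph public

-- Induced subgraph containment: G ∈ C[F] iff there is an injective
-- map V(F) → V(G) preserving adjacency and non-adjacency.

Contains : Graph → Graph → Set
Contains G F =
  Σ (Fin (v F) → Fin (v G)) λ f →
    Injective _≡_ _≡_ f × (∀ i j → adj G (f i) (f j) ≡ adj F i j)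

private
  adj⊎ : ∀ {m n} → (Fin m → Fin m → Bool) → (Fin n → Fin n → Bool)
       → Fin m ⊎ Fin n → Fin m ⊎ Fin n → Bool
  adj⊎ a b (inj₁ i) (inj₁ j) = a i j
  adj⊎ a b (inj₂ i) (inj₂ j) = b i j
  adj⊎ a b (inj₁ _) (inj₂ _) = false
  adj⊎ a b (inj₂ _) (inj₁ _) = false

  sym⊎ : ∀ {m n} (a : Fin m → Fin m → Bool) (b : Fin n → Fin n → Bool)
       → (∀ i j → a i j ≡ a j i) → (∀ i j → b i j ≡ b j i)
       → ∀ x y → adj⊎ a b x y ≡ adj⊎ a b y x
  sym⊎ a b sa sb (inj₁ i) (inj₁ j) = sa i j
  sym⊎ a b sa sb (inj₂ i) (inj₂ j) = sb i j
  sym⊎ a b sa sb (inj₁ _) (inj₂ _) = refl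
  sym⊎ a b sa sb (inj₂ _) (inj₁ _) = refl

  irr⊎ : ∀ {m n} (a : Fin m → Fin m → Bool) (b : Fin n → Fin n → Bool)
       → (∀ i → a i i ≡ false) → (∀ i → b i i ≡ false)
       → ∀ x → adj⊎ a b x x ≡ false
  irr⊎ a b ia ib (inj₁ i) = ia i
  irr⊎ a b ia ib (inj₂ i) = ib i

infixl 5 _⊔_
_⊔_ : Graph → Graph → Graph
A ⊔ B = record
  { v      = v A + v B
  ; adj    = λ i j → adj⊎ (adj A) (adj B) (splitAt (v A) i) (splitAt (v A) j)
  ; sym    = λ i j → sym⊎ (adj A) (adj B) (sym A) (sym B) (splitAt (v A) i) (splitAt (v A) j)
  ; irrefl = λ i → irr⊎ (adj A) (adj B) (irrefl A) (irrefl B) (splitAt (v A) i)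
  }

K₁ : Graph
K₁ = record { v = 1 ; adj = λ _ _ → false ; sym = λ _ _ → refl ; irrefl = λ _ → refl }

private
  p3 : Fin 3 → Fin 3 → Bool
  p3 zero (suc zero) = true
  p3 (suc zero) zero = true
  p3 (suc zero) (suc (suc zero)) = true
  p3 (suc (suc zero)) (suc zero) = true
  p3 _ _ = false

  p3-sym : ∀ i j → p3 i j ≡ p3 j i
  p3-sym zero zero = refl
  p3-sym zero (suc zero) = refl
  p3-sym zero (suc (suc zero)) = refl
  p3-sym (suc zero) zero = refl
  p3-sym (suc zero) (suc zero) = refl
  p3-sym (suc zero) (suc (suc zero)) = refl
  p3-sym (suc (suc zero)) zero = refl
  p3-sym (suc (suc zero)) (suc zero) = refl
  p3-sym (suc (suc zero)) (suc (suc zero)) = refl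

  p3-irr : ∀ i → p3 i i ≡ false
  p3-irr zero = refl
  p3-irr (suc zero) = refl
  p3-irr (suc (suc zero)) = refl

P₃ : Graph
P₃ = record { v = 3 ; adj = p3 ; sym = p3-sym ; irrefl = p3-irr }

-- First-order logic over the signature {∼, =}.  Formula k has k free
-- variables (de Bruijn: variable zero is the most recently bound).

data Formula : ℕ → Set where
  _∼'_ : ∀ {k} → Fin k → Fin k → Formula k
  _≐_  : ∀ {k} → Fin k → Fin k → Formula k
  ¬'_  : ∀ {k} → Formula k → Formula k
  _∧'_ : ∀ {k} → Formula k → Formula k → Formula k
  _∨'_ : ∀ {k} → Formula k → Formula k → Formula k
  ∃'   : ∀ {k} → Formula (suc k) → Formula k
  ∀'   : ∀ {k} → Formula (suc k) → Formula k

Sentence : Set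
Sentence = Formula 0

qd : ∀ {k} → Formula k → ℕ
qd (_ ∼' _) = 0
qd (_ ≐ _)  = 0
qd (¬' φ)   = qd φ
qd (φ ∧' ψ) = qd φ Data.Nat.⊔ qd ψ
qd (φ ∨' ψ) = qd φ Data.Nat.⊔ qd ψ
qd (∃' φ)   = suc (qd φ)
qd (∀' φ)   = suc (qd φ)

extend : ∀ {n k} → Fin n → (Fin k → Fin n) → Fin (suc k) → Fin n
extend a ρ zero    = a
extend a ρ (suc i) = ρ i

Sat : (G : Graph) → ∀ {k} → Formula k → (Fin k → Fin (v G)) → Set
Sat G (i ∼' j) ρ = adj G (ρ i) (ρ j) ≡ true
Sat G (i ≐ j)  ρ = ρ i ≡ ρ j
Sat G (¬' φ)   ρ = Sat G φ ρ → ⊥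
Sat G (φ ∧' ψ) ρ = Sat G φ ρ × Sat G ψ ρ
Sat G (φ ∨' ψ) ρ = Sat G φ ρ ⊎ Sat G ψ ρ
Sat G (∃' φ)   ρ = Σ (Fin (v G)) λ a → Sat G φ (extend a ρ)
Sat G (∀' φ)   ρ = (a : Fin (v G)) → Sat G φ (extend a ρ)

noVars : ∀ {A : Set} → Fin 0 → A
noVars ()

_⊨_ : Graph → Sentence → Set
G ⊨ φ = Sat G φ noVars

Expresses : Sentence → Graph → Set
Expresses φ F = ∀ (G : Graph) → (G ⊨ φ → Contains G F) × (Contains G F → G ⊨ φ)

-- D[F] ≤ d : some sentence of quantifier depth ≤ d expresses C[F]
-- (D[F] is the minimum such depth, so this is exactly D[F] ≤ d.)
D≤ : Graph → ℕ → Set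
D≤ F d = Σ Sentence λ φ → qd φ ≤ d × Expresses φ F

-- Let m = v(H), so v(F) − 1 = m + 3.  The sentence  Φ  guesses the m vertices
-- h of an induced copy of H (m existential quantifiers, whose induced
-- subgraph is pinned down by a quantifier-free diagram) and then, inside the
-- region R of vertices apart (distinct and non-adjacent) from every h i,
-- tests for an induced P₃ ⊔ K₁ with only three nested quantifiers:
--   ∃x. (∃y₁ ∃z₁. x, y₁, z₁ pairwise apart)
--     ∧ (∃y₂. y₂ ∼ x ∧ (∃z₂. z₂ apart from x, y₂) ∧ (∃w. w ∼ y₂, w apart from x)),
-- all witnesses ranging over R.  Such a "certificate" always yields an
-- induced P₃ ⊔ K₁ inside R (the combinatorial heart: module Detection), and
-- every induced P₃ ⊔ K₁ yields a certificate.
module Submission where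

open import Defs
open import Data.Nat using (_∸_)
open import Data.Nat using (ℕ; zero; suc; _+_; _≤_; z≤n; s≤s)
open import Data.Nat.Properties using (⊔-lub; ≤-trans; ≤-reflexive; m≤m+n; +-suc)
open import Data.Fin using (Fin; zero; suc; splitAt; join; _↑ˡ_; _↑ʳ_)
open import Data.Fin.Patterns using (0F; 1F; 2F; 3F)
open import Data.Fin.Properties
  using (_≟_; join-splitAt; splitAt-↑ˡ; splitAt-↑ʳ; ↑ˡ-injective; ↑ʳ-injective)
open import Data.Bool using (Bool; true; false)
open import Data.Bool.Properties using (¬-not; not-¬)
open import Data.Sum using (_⊎_; inj₁; inj₂; [_,_]′)
open import Data.Product using (Σ; _×_; _,_; proj₁; proj₂)
open import Data.Empty using (⊥-elim)
open import Relation.Nullary using (Dec; yes; no)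
open import Relation.Binary.PropositionalEquality
  using (_≡_; _≢_; refl; trans; cong; cong₂) renaming (sym to ≡-sym)
open import Function.Definitions using (Injective)

Vertex : Graph → Set
Vertex G = Fin (v G)

Apart : (G : Graph) → Vertex G → Vertex G → Set
Apart G a b = a ≢ b × adj G a b ≡ false

IsEmbedding : (G A : Graph) → (Vertex A → Vertex G) → Set
IsEmbedding G A f = Injective _≡_ _≡_ f × (∀ i j → adj G (f i) (f j) ≡ adj A i j)

module _ (G : Graph) where

  adj-sym : ∀ {a b t} → adj G a b ≡ t → adj G b a ≡ t
  adj-sym {a} {b} e = trans (Graph.sym G b a) e

  apart-sym : ∀ {a b} → Apart G a b → Apart G b a
  apart-sym (a≢b , ab) = (λ e → a≢b (≡-sym e)) , adj-sym ab

  apart⇒¬adjacent : ∀ {a b} → Apart G a b → adj G a b ≢ true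
  apart⇒¬adjacent (_ , ab) = not-¬ ab

  adjacent⇒distinct : ∀ {a b} → adj G a b ≡ true → a ≢ b
  adjacent⇒distinct {a} ab refl = not-¬ (irrefl G a) ab

  separated⇒distinct : ∀ {a b t} → adj G a t ≡ true → adj G b t ≡ false → a ≢ b
  separated⇒distinct at bt refl = not-¬ bt at

  embedding⇒apart : ∀ {A f} → IsEmbedding G A f → ∀ {i j} → i ≢ j → adj A i j ≡ false →
                    Apart G (f i) (f j)
  embedding⇒apart (inj , pres) {i} {j} i≢j ij = (λ e → i≢j (inj e)) , trans (pres i j) ij

splitAt-injective : ∀ m {n} {i j : Fin (m + n)} → splitAt m i ≡ splitAt m j → i ≡ j
splitAt-injective m {n} {i} {j} e =
  trans (≡-sym (join-splitAt m n i)) (trans (cong (join m n) e) (join-splitAt m n j))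

-- Embeddings of A and of B whose images are mutually apart; by ⊔-intro and
-- ⊔-elim this is exactly an embedding of A ⊔ B.
record ApartEmbeddings (G A B : Graph) : Set where
  field
    left      : Vertex A → Vertex G
    right     : Vertex B → Vertex G
    left-emb  : IsEmbedding G A left
    right-emb : IsEmbedding G B right
    separated : ∀ i j → Apart G (left i) (right j)

module _ (G : Graph) {A B : Graph} where

  glue : (Vertex A → Vertex G) → (Vertex B → Vertex G) → Vertex (A ⊔ B) → Vertex G
  glue f g i = [ f , g ]′ (splitAt (v A) i)

  glue-all : ∀ {Q : Vertex G → Set} {f g} → (∀ i → Q (f i)) → (∀ j → Q (g j)) →
             ∀ i → Q (glue f g i)
  glue-all qf qg i with splitAt (v A) i
  ... | inj₁ p = qf p
  ... | inj₂ q = qg q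

  glue-embedding : (e : ApartEmbeddings G A B) →
                   IsEmbedding G (A ⊔ B) (glue (ApartEmbeddings.left e) (ApartEmbeddings.right e))
  glue-embedding e = glue-injective , glue-adj
    where
    open ApartEmbeddings e
    copair-injective : ∀ {x y : Vertex A ⊎ Vertex B} →
                       [ left , right ]′ x ≡ [ left , right ]′ y → x ≡ y
    copair-injective {inj₁ p} {inj₁ q} eq = cong inj₁ (proj₁ left-emb eq)
    copair-injective {inj₁ p} {inj₂ q} eq = ⊥-elim (proj₁ (separated p q) eq)
    copair-injective {inj₂ p} {inj₁ q} eq = ⊥-elim (proj₁ (separated q p) (≡-sym eq))
    copair-injective {inj₂ p} {inj₂ q} eq = cong inj₂ (proj₁ right-emb eq)
    glue-injective : Injective _≡_ _≡_ (glue left right)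
    glue-injective eq = splitAt-injective (v A) (copair-injective eq)
    glue-adj : ∀ i j → adj G (glue left right i) (glue left right j) ≡ adj (A ⊔ B) i j
    glue-adj i j with splitAt (v A) i | splitAt (v A) j
    ... | inj₁ p | inj₁ q = proj₂ left-emb p q
    ... | inj₁ p | inj₂ q = proj₂ (separated p q)
    ... | inj₂ p | inj₁ q = adj-sym G (proj₂ (separated q p))
    ... | inj₂ p | inj₂ q = proj₂ right-emb p q

  ⊔-intro : ApartEmbeddings G A B → Contains G (A ⊔ B)
  ⊔-intro e = glue (ApartEmbeddings.left e) (ApartEmbeddings.right e) , glue-embedding e

  ⊔-elim : Contains G (A ⊔ B) → ApartEmbeddings G A B
  ⊔-elim (f , inj , pres) = record
    { left      = λ i → f (i ↑ˡ v B)
    ; right     = λ j → f (v A ↑ʳ j)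
    ; left-emb  = (λ e → ↑ˡ-injective (v B) _ _ (inj e)) , λ i j → trans (pres _ _) (adj-ˡˡ i j)
    ; right-emb = (λ e → ↑ʳ-injective (v A) _ _ (inj e)) , λ i j → trans (pres _ _) (adj-ʳʳ i j)
    ; separated = λ i j → (λ e → ↑ˡ≢↑ʳ (inj e)) , trans (pres _ _) (adj-ˡʳ i j)
    }
    where
    adj-ˡˡ : ∀ i j → adj (A ⊔ B) (i ↑ˡ v B) (j ↑ˡ v B) ≡ adj A i j
    adj-ˡˡ i j rewrite splitAt-↑ˡ (v A) i (v B) | splitAt-↑ˡ (v A) j (v B) = refl
    adj-ʳʳ : ∀ i j → adj (A ⊔ B) (v A ↑ʳ i) (v A ↑ʳ j) ≡ adj B i j
    adj-ʳʳ i j rewrite splitAt-↑ʳ (v A) (v B) i | splitAt-↑ʳ (v A) (v B) j = refl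
    adj-ˡʳ : ∀ i j → adj (A ⊔ B) (i ↑ˡ v B) (v A ↑ʳ j) ≡ false
    adj-ˡʳ i j rewrite splitAt-↑ˡ (v A) i (v B) | splitAt-↑ʳ (v A) (v B) j = refl
    ↑ˡ≢↑ʳ : ∀ {i j} → i ↑ˡ v B ≢ v A ↑ʳ j
    ↑ˡ≢↑ʳ {i} {j} e
      with trans (≡-sym (splitAt-↑ˡ (v A) i (v B)))
                 (trans (cong (splitAt (v A)) e) (splitAt-↑ʳ (v A) (v B) j))
    ... | ()

module _ (G : Graph) where

  path : Vertex G → Vertex G → Vertex G → Vertex P₃ → Vertex G
  path a b c 0F = a
  path a b c 1F = b
  path a b c 2F = c

  path-embedding : ∀ {a b c} → adj G a b ≡ true → adj G b c ≡ true → Apart G a c →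
                   IsEmbedding G P₃ (path a b c)
  path-embedding {a} {b} {c} ab bc (a≢c , ac) = injective , preserves
    where
    a≢b = adjacent⇒distinct G ab
    b≢c = adjacent⇒distinct G bc
    injective : ∀ {i j} → path a b c i ≡ path a b c j → i ≡ j
    injective {0F} {0F} e = refl
    injective {0F} {1F} e = ⊥-elim (a≢b e)
    injective {0F} {2F} e = ⊥-elim (a≢c e)
    injective {1F} {0F} e = ⊥-elim (a≢b (≡-sym e))
    injective {1F} {1F} e = refl
    injective {1F} {2F} e = ⊥-elim (b≢c e)
    injective {2F} {0F} e = ⊥-elim (a≢c (≡-sym e))
    injective {2F} {1F} e = ⊥-elim (b≢c (≡-sym e))
    injective {2F} {2F} e = refl
    preserves : ∀ i j → adj G (path a b c i) (path a b c j) ≡ adj P₃ i j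
    preserves 0F 0F = irrefl G a
    preserves 0F 1F = ab
    preserves 0F 2F = ac
    preserves 1F 0F = adj-sym G ab
    preserves 1F 1F = irrefl G b
    preserves 1F 2F = bc
    preserves 2F 0F = adj-sym G ac
    preserves 2F 1F = adj-sym G bc
    preserves 2F 2F = irrefl G c

  point-embedding : ∀ d → IsEmbedding G K₁ (λ _ → d)
  point-embedding d = (λ { {0F} {0F} _ → refl }) , λ _ _ → irrefl G d

-- Detecting an induced P₃ ⊔ K₁ inside a vertex set P of G by a depth-3
-- certificate.

module Detection (G : Graph) (P : Vertex G → Set) where

  record Copy : Set where
    field
      a b c d : Vertex G
      a∈P     : P a
      b∈P     : P b
      c∈P     : P c
      d∈P     : P d
      ab      : adj G a b ≡ true
      bc      : adj G b c ≡ true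
      ac      : Apart G a c
      ad      : Apart G a d
      bd      : Apart G b d
      cd      : Apart G c d

  record Certificate : Set where
    field
      x y₁ z₁ y₂ z₂ w : Vertex G
      x∈P             : P x
      y₁∈P            : P y₁
      z₁∈P            : P z₁
      y₂∈P            : P y₂
      z₂∈P            : P z₂
      w∈P             : P w
      y₁x             : Apart G y₁ x
      z₁x             : Apart G z₁ x
      z₁y₁            : Apart G z₁ y₁
      y₂x             : adj G y₂ x ≡ true
      z₂x             : Apart G z₂ x
      z₂y₂            : Apart G z₂ y₂
      wx              : Apart G w x
      wy₂             : adj G w y₂ ≡ true

  copy⇒certificate : Copy → Certificate
  copy⇒certificate cp = record
    { x = a ; y₁ = c ; z₁ = d ; y₂ = b ; z₂ = d ; w = c
    ; x∈P = a∈P ; y₁∈P = c∈P ; z₁∈P = d∈P ; y₂∈P = b∈P ; z₂∈P = d∈P ; w∈P = c∈P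
    ; y₁x = apart-sym G ac ; z₁x = apart-sym G ad ; z₁y₁ = apart-sym G cd
    ; y₂x = adj-sym G ab ; z₂x = apart-sym G ad ; z₂y₂ = apart-sym G bd
    ; wx = apart-sym G ac ; wy₂ = adj-sym G bc
    }
    where open Copy cp

  path+point : ∀ {p q r t} → P p → P q → P r → P t →
               adj G p q ≡ true → adj G q r ≡ true → Apart G p r →
               Apart G p t → Apart G q t → Apart G r t → Copy
  path+point {p} {q} {r} {t} p∈P q∈P r∈P t∈P pq qr pr pt qt rt = record
    { a = p ; b = q ; c = r ; d = t ; a∈P = p∈P ; b∈P = q∈P ; c∈P = r∈P ; d∈P = t∈P
    ; ab = pq ; bc = qr ; ac = pr ; ad = pt ; bd = qt ; cd = rt }

  -- Conversely every certificate yields a copy.  If z₂ ≁ w, then x ∼ y₂ ∼ w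
  -- plus z₂ is one; otherwise see EdgeCase.
  module _ (cert : Certificate) where
    open Certificate cert

    -- Each of y₁, z₁ either produces a copy directly or lies in
    -- {w, z₂} ∪ (N(w) ∩ N(z₂)); as y₁, z₁ are apart, the latter forces both
    -- to be common neighbours of w and z₂, and then y₁ ∼ w ∼ z₁ plus x is a copy.
    module EdgeCase (z₂w : adj G z₂ w ≡ true) where

      CommonNeighbour : Vertex G → Set
      CommonNeighbour t = adj G t w ≡ true × adj G t z₂ ≡ true

      NearEdge : Vertex G → Set
      NearEdge t = t ≡ w ⊎ t ≡ z₂ ⊎ CommonNeighbour t

      nearEdge-apart : ∀ {s t} → NearEdge s → NearEdge t → Apart G s t →
                       CommonNeighbour s × CommonNeighbour t
      nearEdge-apart (inj₁ refl)        (inj₁ refl)        st = ⊥-elim (proj₁ st refl)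
      nearEdge-apart (inj₁ refl)        (inj₂ (inj₁ refl)) st =
        ⊥-elim (apart⇒¬adjacent G st (adj-sym G z₂w))
      nearEdge-apart (inj₁ refl)        (inj₂ (inj₂ tc))   st =
        ⊥-elim (apart⇒¬adjacent G st (adj-sym G (proj₁ tc)))
      nearEdge-apart (inj₂ (inj₁ refl)) (inj₁ refl)        st = ⊥-elim (apart⇒¬adjacent G st z₂w)
      nearEdge-apart (inj₂ (inj₁ refl)) (inj₂ (inj₁ refl)) st = ⊥-elim (proj₁ st refl)
      nearEdge-apart (inj₂ (inj₁ refl)) (inj₂ (inj₂ tc))   st =
        ⊥-elim (apart⇒¬adjacent G st (adj-sym G (proj₂ tc)))
      nearEdge-apart (inj₂ (inj₂ sc))   (inj₁ refl)        st = ⊥-elim (apart⇒¬adjacent G st (proj₁ sc))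
      nearEdge-apart (inj₂ (inj₂ sc))   (inj₂ (inj₁ refl)) st = ⊥-elim (apart⇒¬adjacent G st (proj₂ sc))
      nearEdge-apart (inj₂ (inj₂ sc))   (inj₂ (inj₂ tc))   st = sc , tc

      -- t apart from x, w and z₂: x ∼ y₂ ∼ w plus t, or x ∼ y₂ ∼ t plus z₂.
      farFromEdge : ∀ {t} → P t → Apart G t x → Apart G t w → Apart G t z₂ → Copy
      farFromEdge {t} t∈P tx tw tz₂ with adj G t y₂ in ty₂
      ... | false = path+point x∈P y₂∈P w∈P t∈P (adj-sym G y₂x) (adj-sym G wy₂) (apart-sym G wx)
                      (apart-sym G tx) (separated⇒distinct G y₂x (proj₂ tx) , adj-sym G ty₂)
                      (apart-sym G tw)
      ... | true  = path+point x∈P y₂∈P t∈P z₂∈P (adj-sym G y₂x) (adj-sym G ty₂) (apart-sym G tx)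
                      (apart-sym G z₂x) (apart-sym G z₂y₂) tz₂

      -- A vertex t apart from x yields a copy unless it is near the edge
      -- (if t ∼ exactly one endpoint, t and the edge form a path, plus x).
      classify : ∀ {t} → P t → Apart G t x → Copy ⊎ NearEdge t
      classify {t} t∈P tx with t ≟ w | t ≟ z₂
      ... | yes t≡w | _        = inj₂ (inj₁ t≡w)
      ... | no _    | yes t≡z₂ = inj₂ (inj₂ (inj₁ t≡z₂))
      ... | no t≢w  | no t≢z₂ with adj G t w in tw | adj G t z₂ in tz₂
      ...   | false | false = inj₁ (farFromEdge t∈P tx (t≢w , tw) (t≢z₂ , tz₂))
      ...   | true  | false = inj₁ (path+point t∈P w∈P z₂∈P x∈P tw (adj-sym G z₂w) (t≢z₂ , tz₂)
                                   tx wx z₂x)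
      ...   | false | true  = inj₁ (path+point t∈P z₂∈P w∈P x∈P tz₂ z₂w (t≢w , tw) tx z₂x wx)
      ...   | true  | true  = inj₂ (inj₂ (inj₂ (refl , refl)))

      copy : Copy
      copy with classify y₁∈P y₁x | classify z₁∈P z₁x
      ... | inj₁ cp | _       = cp
      ... | inj₂ _  | inj₁ cp = cp
      ... | inj₂ y₁-near | inj₂ z₁-near with nearEdge-apart z₁-near y₁-near z₁y₁
      ...   | (z₁w , _) , (y₁w , _) =
        path+point y₁∈P w∈P z₁∈P x∈P y₁w (adj-sym G z₁w) (apart-sym G z₁y₁) y₁x wx z₁x

    certificate⇒copy : Copy
    certificate⇒copy with adj G z₂ w in z₂w
    ... | true  = EdgeCase.copy z₂w
    ... | false = path+point x∈P y₂∈P w∈P z₂∈P (adj-sym G y₂x) (adj-sym G wy₂) (apart-sym G wx)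
                    (apart-sym G z₂x) (apart-sym G z₂y₂)
                    (separated⇒distinct G wy₂ (proj₂ z₂y₂) , adj-sym G z₂w)

  copy-map : Copy → Vertex (P₃ ⊔ K₁) → Vertex G
  copy-map cp = glue G {P₃} {K₁} (path G a b c) (λ _ → d)
    where open Copy cp

  copy-embedding : (cp : Copy) → IsEmbedding G (P₃ ⊔ K₁) (copy-map cp)
  copy-embedding cp = glue-embedding G {P₃} {K₁} record
    { left      = path G a b c
    ; right     = λ _ → d
    ; left-emb  = path-embedding G ab bc ac
    ; right-emb = point-embedding G d
    ; separated = λ { 0F _ → ad ; 1F _ → bd ; 2F _ → cd }
    }
    where open Copy cp

  copy-in-P : (cp : Copy) → ∀ i → P (copy-map cp i)
  copy-in-P cp = glue-all G {P₃} {K₁} {P} (λ { 0F → a∈P ; 1F → b∈P ; 2F → c∈P }) (λ _ → d∈P)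
    where open Copy cp

  embedding⇒copy : ∀ {f} → IsEmbedding G (P₃ ⊔ K₁) f → (∀ i → P (f i)) → Copy
  embedding⇒copy {f} emb f∈P = record
    { a = f 0F ; b = f 1F ; c = f 2F ; d = f 3F
    ; a∈P = f∈P 0F ; b∈P = f∈P 1F ; c∈P = f∈P 2F ; d∈P = f∈P 3F
    ; ab = proj₂ emb 0F 1F
    ; bc = proj₂ emb 1F 2F
    ; ac = embedding⇒apart G {P₃ ⊔ K₁} emb (λ ()) refl
    ; ad = embedding⇒apart G {P₃ ⊔ K₁} emb (λ ()) refl
    ; bd = embedding⇒apart G {P₃ ⊔ K₁} emb (λ ()) refl
    ; cd = embedding⇒apart G {P₃ ⊔ K₁} emb (λ ()) refl
    }

extend-cong : ∀ {n k} {ρ σ : Fin k → Fin n} a → (∀ i → ρ i ≡ σ i) →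
              ∀ i → extend a ρ i ≡ extend a σ i
extend-cong a e zero    = refl
extend-cong a e (suc i) = e i

Sat-cong : (G : Graph) {k : ℕ} (φ : Formula k) {ρ σ : Fin k → Vertex G} →
           (∀ i → ρ i ≡ σ i) → Sat G φ ρ → Sat G φ σ
Sat-cong G (i ∼' j) e s        = trans (cong₂ (adj G) (≡-sym (e i)) (≡-sym (e j))) s
Sat-cong G (i ≐ j)  e s        = trans (≡-sym (e i)) (trans s (e j))
Sat-cong G (¬' φ)   e s t      = s (Sat-cong G φ (λ i → ≡-sym (e i)) t)
Sat-cong G (φ ∧' ψ) e (s , t)  = Sat-cong G φ e s , Sat-cong G ψ e t
Sat-cong G (φ ∨' ψ) e (inj₁ s) = inj₁ (Sat-cong G φ e s)
Sat-cong G (φ ∨' ψ) e (inj₂ t) = inj₂ (Sat-cong G ψ e t)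
Sat-cong G (∃' φ)   e (a , s)  = a , Sat-cong G φ (extend-cong a e) s
Sat-cong G (∀' φ)   e s a      = Sat-cong G φ (extend-cong a e) (s a)

∃* : (n : ℕ) → Formula n → Sentence
∃* zero    φ = φ
∃* (suc n) φ = ∃* n (∃' φ)

∃*-qd : ∀ n {d} (φ : Formula n) → qd φ ≤ d → qd (∃* n φ) ≤ d + n
∃*-qd zero    {d} φ φ≤d = ≤-trans φ≤d (m≤m+n d 0)
∃*-qd (suc n) {d} φ φ≤d =
  ≤-trans (∃*-qd n (∃' φ) (s≤s φ≤d)) (≤-reflexive (≡-sym (+-suc d n)))

∃*-elim : (G : Graph) → ∀ n (φ : Formula n) → G ⊨ ∃* n φ → Σ (Fin n → Vertex G) (Sat G φ)
∃*-elim G zero    φ s = noVars , s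
∃*-elim G (suc n) φ s with ∃*-elim G n (∃' φ) s
... | ρ , a , s′ = extend a ρ , s′

∃*-intro : (G : Graph) → ∀ n (φ : Formula n) (ρ : Fin n → Vertex G) → Sat G φ ρ → G ⊨ ∃* n φ
∃*-intro G zero    φ ρ s = Sat-cong G φ (λ ()) s
∃*-intro G (suc n) φ ρ s =
  ∃*-intro G n (∃' φ) (λ i → ρ (suc i)) (ρ zero , Sat-cong G φ split s)
  where
  split : ∀ i → ρ i ≡ extend (ρ zero) (λ j → ρ (suc j)) i
  split zero    = refl
  split (suc i) = refl

⊤' : ∀ {k} → Formula (suc k)
⊤' = zero ≐ zero

-- Finite conjunction (over a context with at least one variable, where ⊤ is expressible).
⋀ : ∀ {n k} → (Fin n → Formula (suc k)) → Formula (suc k)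
⋀ {zero}  ψ = ⊤'
⋀ {suc n} ψ = ψ zero ∧' ⋀ (λ i → ψ (suc i))

module _ (G : Graph) {k : ℕ} where

  ⋀-elim : ∀ {n} (ψ : Fin n → Formula (suc k)) {ρ} → Sat G (⋀ ψ) ρ → ∀ i → Sat G (ψ i) ρ
  ⋀-elim ψ (s , _) zero    = s
  ⋀-elim ψ (_ , s) (suc i) = ⋀-elim (λ j → ψ (suc j)) s i

  ⋀-intro : ∀ {n} (ψ : Fin n → Formula (suc k)) {ρ} → (∀ i → Sat G (ψ i) ρ) → Sat G (⋀ ψ) ρ
  ⋀-intro {zero}  ψ s = refl
  ⋀-intro {suc n} ψ s = s zero , ⋀-intro (λ j → ψ (suc j)) (λ i → s (suc i))

⋀-qd : ∀ {n k d} (ψ : Fin n → Formula (suc k)) → (∀ i → qd (ψ i) ≤ d) → qd (⋀ ψ) ≤ d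
⋀-qd {zero}  ψ ψ≤d = z≤n
⋀-qd {suc n} ψ ψ≤d = ⊔-lub (ψ≤d zero) (⋀-qd (λ j → ψ (suc j)) (λ i → ψ≤d (suc i)))

apart : ∀ {k} → Fin k → Fin k → Formula k
apart u w = (¬' (u ≐ w)) ∧' (¬' (u ∼' w))

module _ (G : Graph) {a b : Vertex G} where

  apart-sound : a ≢ b × adj G a b ≢ true → Apart G a b
  apart-sound (a≢b , a≁b) = a≢b , ¬-not a≁b

  apart-complete : Apart G a b → a ≢ b × adj G a b ≢ true
  apart-complete (a≢b , ab) = a≢b , not-¬ ab

adjLit : ∀ {k} → Bool → Fin k → Fin k → Formula k
adjLit true  u w = u ∼' w
adjLit false u w = ¬' (u ∼' w)

distinctLit : ∀ {n k} {i j : Fin n} → Dec (i ≡ j) → Fin k → Fin k → Formula k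
distinctLit (yes _) u w = u ≐ u
distinctLit (no _)  u w = ¬' (u ≐ w)

module _ (G : Graph) {k : ℕ} {ρ : Fin k → Vertex G} where

  adjLit-sound : ∀ b {u w} → Sat G (adjLit b u w) ρ → adj G (ρ u) (ρ w) ≡ b
  adjLit-sound true  s = s
  adjLit-sound false s = ¬-not s

  adjLit-complete : ∀ b {u w} → adj G (ρ u) (ρ w) ≡ b → Sat G (adjLit b u w) ρ
  adjLit-complete true  e = e
  adjLit-complete false e = not-¬ e

  distinctLit-sound : ∀ {n} {i j : Fin n} (d : Dec (i ≡ j)) {u w} →
                      Sat G (distinctLit d u w) ρ → ρ u ≡ ρ w → i ≡ j
  distinctLit-sound (yes i≡j) s e = i≡j
  distinctLit-sound (no _)    s e = ⊥-elim (s e)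

  distinctLit-complete : ∀ {n} {i j : Fin n} (d : Dec (i ≡ j)) {u w} →
                         (ρ u ≡ ρ w → i ≡ j) → Sat G (distinctLit d u w) ρ
  distinctLit-complete (yes _)  h   = refl
  distinctLit-complete (no i≢j) h e = i≢j (h e)

Outside : (G : Graph) → ∀ {m} → (Fin m → Vertex G) → Vertex G → Set
Outside G h a = ∀ j → Apart G a (h j)

diagram : ∀ {k} (H : Graph) → (Fin (v H) → Fin (suc k)) → Formula (suc k)
diagram H hv = ⋀ λ i → ⋀ λ j →
  adjLit (adj H i j) (hv i) (hv j) ∧' distinctLit (i ≟ j) (hv i) (hv j)

outside : ∀ {k m} → Fin (suc k) → (Fin m → Fin (suc k)) → Formula (suc k)
outside u hv = ⋀ λ i → apart u (hv i)

diagram-qd : ∀ {k d} (H : Graph) (hv : Fin (v H) → Fin (suc k)) → qd (diagram H hv) ≤ d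
diagram-qd H hv = ⋀-qd _ λ i → ⋀-qd _ λ j → ⊔-lub (adjLit-qd (adj H i j)) (distinctLit-qd (i ≟ j))
  where
  adjLit-qd : ∀ {k d} b {u w : Fin k} → qd (adjLit b u w) ≤ d
  adjLit-qd true  = z≤n
  adjLit-qd false = z≤n
  distinctLit-qd : ∀ {n k d} {i j : Fin n} (dec : Dec (i ≡ j)) {u w : Fin k} →
                   qd (distinctLit dec u w) ≤ d
  distinctLit-qd (yes _) = z≤n
  distinctLit-qd (no _)  = z≤n

outside-qd : ∀ {k m d} (u : Fin (suc k)) (hv : Fin m → Fin (suc k)) → qd (outside u hv) ≤ d
outside-qd u hv = ⋀-qd (λ i → apart u (hv i)) λ i → z≤n

module _ (G : Graph) {k : ℕ} {ρ : Fin (suc k) → Vertex G} where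

  diagram-sound : ∀ H {hv} → Sat G (diagram H hv) ρ → IsEmbedding G H (λ i → ρ (hv i))
  diagram-sound H {hv} s = injective , preserves
    where
    literal : ∀ i j → Sat G (adjLit (adj H i j) (hv i) (hv j) ∧' distinctLit (i ≟ j) (hv i) (hv j)) ρ
    literal i j = ⋀-elim G _ (⋀-elim G _ s i) j
    injective : ∀ {i j} → ρ (hv i) ≡ ρ (hv j) → i ≡ j
    injective {i} {j} = distinctLit-sound G (i ≟ j) (proj₂ (literal i j))
    preserves : ∀ i j → adj G (ρ (hv i)) (ρ (hv j)) ≡ adj H i j
    preserves i j = adjLit-sound G (adj H i j) (proj₁ (literal i j))

  diagram-complete : ∀ H {hv} → IsEmbedding G H (λ i → ρ (hv i)) → Sat G (diagram H hv) ρ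
  diagram-complete H (injective , preserves) = ⋀-intro G _ λ i → ⋀-intro G _ λ j →
    adjLit-complete G (adj H i j) (preserves i j) , distinctLit-complete G (i ≟ j) injective

  outside-sound : ∀ {m u} {hv : Fin m → Fin (suc k)} → Sat G (outside u hv) ρ →
                  Outside G (λ i → ρ (hv i)) (ρ u)
  outside-sound {u = u} {hv} s j = apart-sound G (⋀-elim G (λ i → apart u (hv i)) s j)

  outside-complete : ∀ {m u} {hv : Fin m → Fin (suc k)} → Outside G (λ i → ρ (hv i)) (ρ u) →
                     Sat G (outside u hv) ρ
  outside-complete {u = u} {hv} o = ⋀-intro G (λ i → apart u (hv i)) λ j → apart-complete G (o j)

module Expressing (H : Graph) where

  m : ℕ
  m = v H

  -- The variables of the copy of H, below j more recently bound variables.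
  hs : (j : ℕ) → Fin m → Fin (j + m)
  hs j = j ↑ʳ_

  -- Context (y₁, x, h): y₁ outside, apart from x, and some z₁ outside apart from x, y₁.
  independentPair : Formula (2 + m)
  independentPair =
    outside 0F (hs 2) ∧' (apart 0F 1F ∧' ∃' (outside 0F (hs 3) ∧' (apart 0F 2F ∧' apart 0F 1F)))

  -- Context (y₂, x, h): y₂ outside with y₂ ∼ x; some z₂ outside apart from x, y₂;
  -- some w outside, apart from x, with w ∼ y₂.
  pendantPath : Formula (2 + m)
  pendantPath =
    outside 0F (hs 2) ∧' ((0F ∼' 1F) ∧'
      (∃' (outside 0F (hs 3) ∧' (apart 0F 2F ∧' apart 0F 1F)) ∧'
       ∃' (outside 0F (hs 3) ∧' (apart 0F 2F ∧' (0F ∼' 1F)))))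

  body : Formula m
  body = ∃' (diagram H (hs 1) ∧' (outside 0F (hs 1) ∧' (∃' independentPair ∧' ∃' pendantPath)))

  body-qd : qd body ≤ 3
  body-qd =
    s≤s (⊔-lub (diagram-qd H (hs 1)) (⊔-lub (outside-qd 0F (hs 1)) (⊔-lub pair-qd path-qd)))
    where
    pair-qd : qd (∃' independentPair) ≤ 2
    pair-qd = s≤s (⊔-lub (outside-qd 0F (hs 2))
                         (⊔-lub z≤n (s≤s (⊔-lub (outside-qd 0F (hs 3)) z≤n))))
    path-qd : qd (∃' pendantPath) ≤ 2
    path-qd = s≤s (⊔-lub (outside-qd 0F (hs 2)) (⊔-lub z≤n (⊔-lub
      (s≤s (⊔-lub (outside-qd 0F (hs 3)) z≤n)) (s≤s (⊔-lub (outside-qd 0F (hs 3)) z≤n)))))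

  module _ (G : Graph) where
    open Detection G

    body-sound : ∀ {ρ} → Sat G body ρ → IsEmbedding G H ρ × Certificate (Outside G ρ)
    body-sound (x , diag , x-out , (y₁ , y₁-out , y₁x , z₁ , z₁-out , z₁x , z₁y₁) ,
                (y₂ , y₂-out , y₂x , (z₂ , z₂-out , z₂x , z₂y₂) , (w , w-out , wx , wy₂))) =
      diagram-sound G H diag , record
        { x = x ; y₁ = y₁ ; z₁ = z₁ ; y₂ = y₂ ; z₂ = z₂ ; w = w
        ; x∈P = outside-sound G x-out ; y₁∈P = outside-sound G y₁-out
        ; z₁∈P = outside-sound G z₁-out ; y₂∈P = outside-sound G y₂-out
        ; z₂∈P = outside-sound G z₂-out ; w∈P = outside-sound G w-out
        ; y₁x = apart-sound G y₁x ; z₁x = apart-sound G z₁x ; z₁y₁ = apart-sound G z₁y₁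
        ; y₂x = y₂x ; z₂x = apart-sound G z₂x ; z₂y₂ = apart-sound G z₂y₂
        ; wx = apart-sound G wx ; wy₂ = wy₂
        }

    body-complete : ∀ {ρ} → IsEmbedding G H ρ → Certificate (Outside G ρ) → Sat G body ρ
    body-complete {ρ} emb cert =
      x , diagram-complete G H emb , outside-complete G x∈P ,
      (y₁ , outside-complete G y₁∈P , apart-complete G y₁x ,
       z₁ , outside-complete G z₁∈P , apart-complete G z₁x , apart-complete G z₁y₁) ,
      (y₂ , outside-complete G y₂∈P , y₂x ,
       (z₂ , outside-complete G z₂∈P , apart-complete G z₂x , apart-complete G z₂y₂) ,
       (w , outside-complete G w∈P , apart-complete G wx , wy₂))
      where open Certificate (Outside G ρ) cert

  Φ : Sentence
  Φ = ∃* m body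

  sound : (G : Graph) → G ⊨ Φ → Contains G (P₃ ⊔ K₁ ⊔ H)
  sound G s with ∃*-elim G m body s
  ... | ρ , sat with body-sound G sat
  ...   | emb , cert = ⊔-intro G {P₃ ⊔ K₁} {H} record
          { left = copy-map copy ; right = ρ ; left-emb = copy-embedding copy
          ; right-emb = emb ; separated = copy-in-P copy }
    where
    open Detection G (Outside G ρ)
    copy : Copy
    copy = certificate⇒copy cert

  complete : (G : Graph) → Contains G (P₃ ⊔ K₁ ⊔ H) → G ⊨ Φ
  complete G c = ∃*-intro G m body right
    (body-complete G right-emb (copy⇒certificate (embedding⇒copy left-emb separated)))
    where
    open ApartEmbeddings (⊔-elim G {P₃ ⊔ K₁} {H} c)
    open Detection G (Outside G right)

theorem1 : (H : Graph) → D≤ (P₃ ⊔ K₁ ⊔ H) (v (P₃ ⊔ K₁ ⊔ H) ∸ 1)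
theorem1 H = Φ , ∃*-qd m body body-qd , λ G → sound G , complete G
  where open Expressing H
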